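{- For every integer $n\ge 1$, $\mathrm{a}_{010,021}(n)=2^{n-1}$.
   Context: An ascent of an integer word $x_1\cdots x_n$ is an index $j$ with $x_j<x_{j+1}$; $\mathrm{asc}(x_1\cdots x_n)$ denotes the number of ascents. An ascent sequence of length $n$ is a sequence $x_1\cdots x_n$ of nonnegative integers with $x_1=0$ and $x_i\le \mathrm{asc}(x_1\cdots x_{i-1})+1$ for all $1<i\le n$. A pattern is a word $p=p_1\cdots p_k$ of nonnegative integers whose set of values is $\{0,1,\dots,m\}$ for some $m$. A word $x_1\cdots x_n$ contains $p$ if there are indices $i_1<\cdots<i_k$ such that $x_{i_1}\cdots x_{i_k}$ is order-isomorphic to $p$ (i.e. for all $s,t$, $x_{i_s}<x_{i_t}$ iff $p_s<p_t$ and $x_{i_s}=x_{i_t}$ iff $p_s=p_t$); otherwise it avoids $p$. For a list $B$ of patterns, $\mathcal{A}_B(n)$ is the set of ascent sequences of length $n$ avoiding every pattern in $B$, and $\mathrm{a}_B(n)=|\mathcal{A}_B(n)|$. -}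

module Defs where

open import Data.Nat using (ℕ; zero; suc; _+_; _<ᵇ_; _≡ᵇ_; _≤ᵇ_)
open import Data.Bool using (Bool; true; false; _∧_; _∨_; not; if_then_else_)
open import Data.List using (List; []; _∷_; length; reverse)

asc : List ℕ → ℕ
asc [] = 0
asc (x ∷ []) = 0
asc (x ∷ y ∷ w) = (if x <ᵇ y then 1 else 0) + asc (y ∷ w)

-- Ascent-sequence check, processed left to right.
-- ascOK prev a w : given the last letter prev and a = asc of the prefix
-- read so far, every remaining letter x satisfies x ≤ asc(prefix) + 1.
ascOK : ℕ → ℕ → List ℕ → Bool
ascOK prev a [] = true
ascOK prev a (x ∷ w) =
  (x ≤ᵇ suc a) ∧ ascOK x (if prev <ᵇ x then suc a else a) w

-- x_1 = 0 and x_i ≤ asc(x_1 ⋯ x_{i-1}) + 1 for 1 < i ≤ n.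
-- (The empty word is accepted; the statement only concerns n ≥ 1.)
isAscSeq : List ℕ → Bool
isAscSeq [] = true
isAscSeq (x ∷ w) = (x ≡ᵇ 0) ∧ ascOK x 0 w

sameOrder : ℕ → ℕ → ℕ → ℕ → Bool
sameOrder a b c d = ((a <ᵇ b) ≡ᵇB (c <ᵇ d)) ∧ ((a ≡ᵇ b) ≡ᵇB (c ≡ᵇ d))
  where
  _≡ᵇB_ : Bool → Bool → Bool
  true ≡ᵇB y = y
  false ≡ᵇB y = not y

agreeWith : ℕ → ℕ → List ℕ → List ℕ → Bool
agreeWith x p [] [] = true
agreeWith x p (u ∷ us) (q ∷ qs) =
  sameOrder x u p q ∧ sameOrder u x q p ∧ agreeWith x p us qs
agreeWith x p _ _ = false

orderIso : List ℕ → List ℕ → Bool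
orderIso [] [] = true
orderIso (u ∷ us) (p ∷ ps) = agreeWith u p us ps ∧ orderIso us ps
orderIso _ _ = false

-- containsAux w chosen p : some subsequence s of w, appended to the
-- (reversed) already chosen letters, is order-isomorphic to p.
containsAux : List ℕ → List ℕ → List ℕ → Bool
containsAux w chosenRev p with length chosenRev ≡ᵇ length p
... | true = orderIso (reverse chosenRev) p
... | false = go w
  where
  go : List ℕ → Bool
  go [] = false
  go (x ∷ w') = containsAux w' (x ∷ chosenRev) p ∨ go w'

contains : List ℕ → List ℕ → Bool
contains w p = containsAux w [] p

avoids : List ℕ → List ℕ → Bool
avoids w p = not (contains w p)

-- A_{010,021}(n): ascent sequences of length n avoiding 010 and 021.
-- Bool-valued conditions make membership proof-irrelevant, so a bijection
-- with Fin k means the set has exactly k elements.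
A-010-021 : ℕ → Set
A-010-021 n = Σ' (List ℕ) (λ w → Cond n w)
  where
  open import Data.Product using () renaming (Σ to Σ')
  open import Relation.Binary.PropositionalEquality using (_≡_)
  Cond : ℕ → List ℕ → Set
  Cond n w = ((length w ≡ᵇ n) ∧ isAscSeq w ∧ avoids w (0 ∷ 1 ∷ 0 ∷ [])
                ∧ avoids w (0 ∷ 2 ∷ 1 ∷ [])) ≡ true

-- A word starting with 0 avoids 010 and 021 exactly when it has no inversion: an inversion
-- b < a (a before b) after the leading 0 forms 010 if b = 0 and 021 otherwise, while a weakly
-- increasing word contains no pattern with a descent. In a weakly increasing ascent sequence
-- the number of ascents is the last letter, so the ascent condition only lets each letter
-- repeat its predecessor or exceed it by one. Such "staircases" of length n + 1 are
-- determined by their n steps, i.e. by a bit vector of length n.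

module Submission where

open import Defs
open import Axiom.UniquenessOfIdentityProofs using (module Decidable⇒UIP)
open import Data.Bool using (Bool; true; false; T; _∧_; _∨_)
open import Data.Bool.Properties using (T-≡; T-∧; T-∨; T?) renaming (_≟_ to _≟ᵇ_)
open import Data.Fin using (Fin; zero)
open import Data.Fin.Properties using (2↔Bool; *↔×)
open import Data.List using (List; []; _∷_; length; reverse; _ʳ++_)
open import Data.List.Relation.Binary.Sublist.Propositional using (_⊆_; []; _∷_; _∷ʳ_; minimum)
open import Data.List.Relation.Binary.Sublist.Propositional.Properties using (All-resp-⊆)
open import Data.List.Relation.Unary.AllPairs using (AllPairs; []; _∷_)
open import Data.List.Relation.Unary.All using ([]; _∷_)
open import Data.List.Relation.Unary.Linked using (Linked; []; [-]; _∷_)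
open import Data.List.Relation.Unary.Linked.Properties using (Linked⇒AllPairs)
open import Data.Nat using (ℕ; zero; suc; _+_; _^_; _≤_; _<_; z≤n; _<ᵇ_; _≡ᵇ_; _≤ᵇ_)
open import Data.Nat.Properties
  using ( ≤-refl; ≤-trans; ≤-antisym; <⇒≤; <⇒≢; >⇒≢; ≤⇒≯; ≮⇒≥; <-cmp; n≤1+n; n<1+n
        ; m≤n⇒m<n∨m≡n; m+1+n≢m; +-suc; +-identityʳ
        ; <⇒<ᵇ; <ᵇ⇒<; ≤⇒≤ᵇ; ≤ᵇ⇒≤; ≡⇒≡ᵇ; ≡ᵇ⇒≡ )
open import Data.Product using (_×_; _,_; proj₁; proj₂; ∃-syntax; uncurry)
open import Data.Product.Function.NonDependent.Propositional using (_×-↔_; _×-⇔_)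
open import Data.Product.Properties using (Σ-≡,≡→≡)
open import Data.Sum using (_⊎_; inj₁; inj₂; [_,_]′)
open import Data.Vec using (Vec; []; _∷_; replicate; uncons)
open import Function using (_∘_)
open import Function.Bundles using (_↔_; _⇔_; mk↔ₛ′; mk⇔; module Equivalence)
open import Function.Construct.Composition using (_⇔-∘_)
open import Function.Construct.Identity using (⇔-id)
open import Function.Properties.Inverse using (↔-trans; ↔-sym)
open import Relation.Binary.Definitions using (tri<; tri≈; tri>)
open import Relation.Binary.PropositionalEquality
  using (_≡_; _≢_; refl; sym; trans; cong; subst)
open import Relation.Nullary using (¬_; yes; no; contradiction)

open Equivalence using (to; from)

¬T⇒≡false : ∀ {b} → ¬ T b → b ≡ false
¬T⇒≡false {false} _  = refl
¬T⇒≡false {true}  ¬t = contradiction _ ¬t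

<ᵇ-true : ∀ {m n} → m < n → (m <ᵇ n) ≡ true
<ᵇ-true = to T-≡ ∘ <⇒<ᵇ

<ᵇ-false : ∀ {m n} → n ≤ m → (m <ᵇ n) ≡ false
<ᵇ-false {m} {n} n≤m = ¬T⇒≡false (≤⇒≯ n≤m ∘ <ᵇ⇒< m n)

≤ᵇ-true : ∀ {m n} → m ≤ n → (m ≤ᵇ n) ≡ true
≤ᵇ-true = to T-≡ ∘ ≤⇒≤ᵇ

≡ᵇ-refl : ∀ m → (m ≡ᵇ m) ≡ true
≡ᵇ-refl m = to T-≡ (≡⇒≡ᵇ m m refl)

≡ᵇ-false : ∀ {m n} → m ≢ n → (m ≡ᵇ n) ≡ false
≡ᵇ-false {m} {n} m≢n = ¬T⇒≡false (m≢n ∘ ≡ᵇ⇒≡ m n)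

length-ʳ++ : ∀ {A : Set} (xs ys : List A) → length (xs ʳ++ ys) ≡ length xs + length ys
length-ʳ++ []       ys = refl
length-ʳ++ (x ∷ xs) ys = trans (length-ʳ++ xs (x ∷ ys)) (+-suc (length xs) (length ys))

AllPairs-resp-⊆ : ∀ {A : Set} {R : A → A → Set} {xs ys} → xs ⊆ ys → AllPairs R ys → AllPairs R xs
AllPairs-resp-⊆ []          []         = []
AllPairs-resp-⊆ (y ∷ʳ xs⊆ys) (_ ∷ pys)  = AllPairs-resp-⊆ xs⊆ys pys
AllPairs-resp-⊆ (refl ∷ xs⊆ys) (py ∷ pys) = All-resp-⊆ xs⊆ys py ∷ AllPairs-resp-⊆ xs⊆ys pys

Linked-fromPairs : ∀ {A : Set} {R : A → A → Set} {xs} →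
                   (∀ {a b} → a ∷ b ∷ [] ⊆ xs → R a b) → Linked R xs
Linked-fromPairs {xs = []}         _    = []
Linked-fromPairs {xs = x ∷ []}     _    = [-]
Linked-fromPairs {xs = x ∷ y ∷ xs} pair =
  pair (refl ∷ refl ∷ minimum xs) ∷ Linked-fromPairs (pair ∘ (x ∷ʳ_))

T-sameOrder : ∀ y z q r → T (sameOrder y z q r) ⇔ ((y <ᵇ z) ≡ (q <ᵇ r) × (y ≡ᵇ z) ≡ (q ≡ᵇ r))
T-sameOrder y z q r = mk⇔ sound complete
  where
  sound : T (sameOrder y z q r) → (y <ᵇ z) ≡ (q <ᵇ r) × (y ≡ᵇ z) ≡ (q ≡ᵇ r)
  sound h with y <ᵇ z | q <ᵇ r | y ≡ᵇ z | q ≡ᵇ r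
  ... | true  | true  | true  | true  = refl , refl
  ... | true  | true  | false | false = refl , refl
  ... | false | false | true  | true  = refl , refl
  ... | false | false | false | false = refl , refl
  complete : (y <ᵇ z) ≡ (q <ᵇ r) × (y ≡ᵇ z) ≡ (q ≡ᵇ r) → T (sameOrder y z q r)
  complete (lt , eq) rewrite lt | eq with q <ᵇ r | q ≡ᵇ r
  ... | true  | true  = _
  ... | true  | false = _
  ... | false | true  = _
  ... | false | false = _

sameOrder-descent : ∀ {y z q r} → T (sameOrder y z q r) → r < q → z < y
sameOrder-descent {y} {z} {q} {r} h r<q with to (T-sameOrder y z q r) h | <-cmp y z
... | lt , _  | tri< y<z _ _ =
  contradiction (trans (sym (<ᵇ-true y<z)) (trans lt (<ᵇ-false (<⇒≤ r<q)))) λ ()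
... | _  , eq | tri≈ _ refl _ =
  contradiction (trans (sym (≡ᵇ-refl y)) (trans eq (≡ᵇ-false (>⇒≢ r<q)))) λ ()
... | _       | tri> _ _ z<y = z<y

orderIso-length : ∀ u p → T (orderIso u p) → length u ≡ length p
orderIso-length []      []      _   = refl
orderIso-length (x ∷ u) (q ∷ p) iso = cong suc (orderIso-length u p (proj₂ (to T-∧ iso)))

orderIso-sameOrder₂₃ : ∀ x y z p q r →
                       T (orderIso (x ∷ y ∷ z ∷ []) (p ∷ q ∷ r ∷ [])) → T (sameOrder y z q r)
orderIso-sameOrder₂₃ x y z p q r iso =
  proj₁ (to (T-∧ {sameOrder y z q r})
    (proj₁ (to T-∧ (proj₂ (to (T-∧ {agreeWith x p (y ∷ z ∷ []) (q ∷ r ∷ [])}) iso)))))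

ascending-≇-descent : ∀ u {p q r} → AllPairs _≤_ u → r < q → ¬ T (orderIso u (p ∷ q ∷ r ∷ []))
ascending-≇-descent []       _ _ ()
ascending-≇-descent (_ ∷ []) _ _ ()
ascending-≇-descent u@(_ ∷ _ ∷ []) {p} {q} {r} _ _ iso
  with orderIso-length u (p ∷ q ∷ r ∷ []) iso
... | ()
ascending-≇-descent (x ∷ y ∷ z ∷ []) {p} {q} {r} (_ ∷ (y≤z ∷ []) ∷ _) r<q iso =
  ≤⇒≯ y≤z (sameOrder-descent (orderIso-sameOrder₂₃ x y z p q r iso) r<q)
ascending-≇-descent u@(_ ∷ _ ∷ _ ∷ _ ∷ _) {p} {q} {r} _ _ iso
  with orderIso-length u (p ∷ q ∷ r ∷ []) iso
... | ()

orderIso-ʳ++-length : ∀ c s p → T (orderIso (c ʳ++ s) p) → length c + length s ≡ length p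
orderIso-ʳ++-length c s p iso = trans (sym (length-ʳ++ c s)) (orderIso-length (c ʳ++ s) p iso)

containsAux-full : ∀ w c p → T (length c ≡ᵇ length p) → containsAux w c p ≡ orderIso (reverse c) p
containsAux-full w c p full rewrite to T-≡ full = refl

containsAux-[] : ∀ c p → ¬ T (length c ≡ᵇ length p) → containsAux [] c p ≡ false
containsAux-[] c p short rewrite ¬T⇒≡false short = refl

containsAux-∷ : ∀ x w c p → ¬ T (length c ≡ᵇ length p) →
                containsAux (x ∷ w) c p ≡ containsAux w (x ∷ c) p ∨ containsAux w c p
containsAux-∷ x w c p short rewrite ¬T⇒≡false short = refl

containsAux-sound : ∀ w c p → T (containsAux w c p) → ∃[ s ] s ⊆ w × T (orderIso (c ʳ++ s) p)
containsAux-sound w c p h with T? (length c ≡ᵇ length p)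
... | yes full = [] , minimum w , subst T (containsAux-full w c p full) h
containsAux-sound [] c p h | no short = contradiction (subst T (containsAux-[] c p short) h) λ ()
containsAux-sound (x ∷ w) c p h | no short with to T-∨ (subst T (containsAux-∷ x w c p short) h)
... | inj₁ h₁ with containsAux-sound w (x ∷ c) p h₁
...   | s , s⊆w , iso = x ∷ s , refl ∷ s⊆w , iso
containsAux-sound (x ∷ w) c p h | no short | inj₂ h₂ with containsAux-sound w c p h₂
...   | s , s⊆w , iso = s , x ∷ʳ s⊆w , iso

containsAux-complete : ∀ {s w} → s ⊆ w → ∀ c p → T (orderIso (c ʳ++ s) p) → T (containsAux w c p)
containsAux-complete {s} {w} s⊆w c p iso with T? (length c ≡ᵇ length p)
containsAux-complete {[]} {w} _ c p iso | yes full =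
  subst T (sym (containsAux-full w c p full)) iso
containsAux-complete {y ∷ s} _ c p iso | yes full =
  contradiction (trans (orderIso-ʳ++-length c (y ∷ s) p iso) (sym (≡ᵇ⇒≡ _ _ full))) (m+1+n≢m (length c))
containsAux-complete [] c p iso | no short =
  contradiction (≡⇒≡ᵇ _ _ (trans (sym (+-identityʳ (length c))) (orderIso-ʳ++-length c [] p iso))) short
containsAux-complete (x ∷ʳ s⊆w) c p iso | no short =
  subst T (sym (containsAux-∷ x _ c p short)) (from T-∨ (inj₂ (containsAux-complete s⊆w c p iso)))
containsAux-complete (refl ∷ s⊆w) c p iso | no short =
  subst T (sym (containsAux-∷ _ _ c p short)) (from T-∨ (inj₁ (containsAux-complete s⊆w (_ ∷ c) p iso)))

contains-sound : ∀ w p → T (contains w p) → ∃[ s ] s ⊆ w × T (orderIso s p)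
contains-sound w p = containsAux-sound w [] p

contains-complete : ∀ {s} w p → s ⊆ w → T (orderIso s p) → T (contains w p)
contains-complete w p s⊆w = containsAux-complete s⊆w [] p

T-avoids : ∀ w p → T (avoids w p) ⇔ (∀ {s} → s ⊆ w → ¬ T (orderIso s p))
T-avoids w p = mk⇔ avoid⇒none none⇒avoid
  where
  avoid⇒none : T (avoids w p) → ∀ {s} → s ⊆ w → ¬ T (orderIso s p)
  avoid⇒none av s⊆w iso with contains w p | contains-complete w p s⊆w iso
  ... | true | _ = av
  none⇒avoid : (∀ {s} → s ⊆ w → ¬ T (orderIso s p)) → T (avoids w p)
  none⇒avoid none with contains w p | contains-sound w p
  ... | true  | sound = let s , s⊆w , iso = sound _ in none s⊆w iso
  ... | false | _     = _

sorted-avoids-descent : ∀ {w} p {q r} → Linked _≤_ w → r < q → T (avoids w (p ∷ q ∷ r ∷ []))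
sorted-avoids-descent {w} p sorted r<q = from (T-avoids w _) λ {s} s⊆w →
  ascending-≇-descent s (AllPairs-resp-⊆ s⊆w (Linked⇒AllPairs ≤-trans sorted)) r<q

inversion-after-0 : ∀ {a b} → b < a → T (orderIso (0 ∷ a ∷ b ∷ []) (0 ∷ 1 ∷ 0 ∷ []))
                                    ⊎ T (orderIso (0 ∷ a ∷ b ∷ []) (0 ∷ 2 ∷ 1 ∷ []))
inversion-after-0 {suc a} {zero}  _   = inj₁ _
inversion-after-0 {suc a} {suc b} b<a =
  inj₂ (from T-∧ (from T-∧ (a⋯b≅21 , from T-∧ (b⋯a≅12 , _)) , _))
  where
  a⋯b≅21 : T (sameOrder (suc a) (suc b) 2 1)
  a⋯b≅21 = from (T-sameOrder (suc a) (suc b) 2 1) (<ᵇ-false (<⇒≤ b<a) , ≡ᵇ-false (>⇒≢ b<a))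
  b⋯a≅12 : T (sameOrder (suc b) (suc a) 1 2)
  b⋯a≅12 = from (T-sameOrder (suc b) (suc a) 1 2) (<ᵇ-true b<a , ≡ᵇ-false (<⇒≢ b<a))

avoiding-sorted : ∀ {t} → T (avoids (0 ∷ t) (0 ∷ 1 ∷ 0 ∷ [])) → T (avoids (0 ∷ t) (0 ∷ 2 ∷ 1 ∷ [])) →
                  Linked _≤_ (0 ∷ t)
avoiding-sorted {t} av₁ av₂ = Linked-fromPairs ordered
  where
  ordered : ∀ {a b} → a ∷ b ∷ [] ⊆ 0 ∷ t → a ≤ b
  ordered (refl ∷ _)  = z≤n
  ordered (_ ∷ʳ ab⊆t) = ≮⇒≥ λ b<a →
    [ to (T-avoids (0 ∷ t) _) av₁ (refl ∷ ab⊆t) , to (T-avoids (0 ∷ t) _) av₂ (refl ∷ ab⊆t) ]′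
      (inversion-after-0 b<a)

data Staircase : ℕ → List ℕ → Set where
  []   : ∀ {v} → Staircase v []
  flat : ∀ {v t} → Staircase v t → Staircase v (v ∷ t)
  rise : ∀ {v t} → Staircase (suc v) t → Staircase v (suc v ∷ t)

staircase-sorted : ∀ {v t} → Staircase v t → Linked _≤_ (v ∷ t)
staircase-sorted []           = [-]
staircase-sorted (flat s)     = ≤-refl ∷ staircase-sorted s
staircase-sorted {v} (rise s) = n≤1+n v ∷ staircase-sorted s

-- In ascOK prev a, the ascent count a equals the previous letter along a staircase.
ascOK-flat : ∀ v t → ascOK v v (v ∷ t) ≡ ascOK v v t
ascOK-flat v t rewrite ≤ᵇ-true (n≤1+n v) | <ᵇ-false (≤-refl {v}) = refl

ascOK-rise : ∀ v t → ascOK v v (suc v ∷ t) ≡ ascOK (suc v) (suc v) t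
ascOK-rise v t rewrite <ᵇ-true (n<1+n v) = refl

staircase-ascOK : ∀ {v t} → Staircase v t → T (ascOK v v t)
staircase-ascOK []                  = _
staircase-ascOK {v} {_ ∷ t} (flat s) = subst T (sym (ascOK-flat v t)) (staircase-ascOK s)
staircase-ascOK {v} {_ ∷ t} (rise s) = subst T (sym (ascOK-rise v t)) (staircase-ascOK s)

sorted-staircase : ∀ {v} t → T (ascOK v v t) → Linked _≤_ (v ∷ t) → Staircase v t
sorted-staircase []      _  _               = []
sorted-staircase {v} (x ∷ t) ok (v≤x ∷ sorted) with m≤n⇒m<n∨m≡n v≤x
... | inj₂ refl = flat (sorted-staircase t (subst T (ascOK-flat v t) ok) sorted)
... | inj₁ v<x with ≤-antisym (≤ᵇ⇒≤ x (suc v) (proj₁ (to T-∧ ok))) v<x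
...   | refl = rise (sorted-staircase t (subst T (ascOK-rise v t) ok) sorted)

-- The condition defining A-010-021 n in Defs, where it is local.
inA-010-021 : ℕ → List ℕ → Bool
inA-010-021 n w =
  (length w ≡ᵇ n) ∧ isAscSeq w ∧ avoids w (0 ∷ 1 ∷ 0 ∷ []) ∧ avoids w (0 ∷ 2 ∷ 1 ∷ [])

T-inA : ∀ n w → T (inA-010-021 n w) ⇔
        (T (length w ≡ᵇ n) × T (isAscSeq w) ×
         T (avoids w (0 ∷ 1 ∷ 0 ∷ [])) × T (avoids w (0 ∷ 2 ∷ 1 ∷ [])))
T-inA n w = (⇔-id _ ×-⇔ (⇔-id _ ×-⇔ T-∧) ⇔-∘ T-∧) ⇔-∘ T-∧

staircase⇒inA : ∀ {n t} → Staircase 0 t → length t ≡ n → T (inA-010-021 (suc n) (0 ∷ t))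
staircase⇒inA {n} {t} s len = from (T-inA (suc n) (0 ∷ t))
  (≡⇒≡ᵇ (length t) n len , staircase-ascOK s ,
   sorted-avoids-descent 0 sorted (n<1+n 0) , sorted-avoids-descent 0 sorted (n<1+n 1))
  where
  sorted : Linked _≤_ (0 ∷ t)
  sorted = staircase-sorted s

inA⇒staircase : ∀ {n} x t → T (inA-010-021 (suc n) (x ∷ t)) → x ≡ 0 × length t ≡ n × Staircase 0 t
inA⇒staircase {n} zero t h =
  let len , ok , av₁ , av₂ = to (T-inA (suc n) (0 ∷ t)) h
  in refl , ≡ᵇ⇒≡ (length t) n len , sorted-staircase t ok (avoiding-sorted av₁ av₂)
inA⇒staircase {n} (suc x) t h with to (T-inA (suc n) (suc x ∷ t)) h
... | _ , () , _

climb : ∀ {n} → ℕ → Vec Bool n → List ℕ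
climb v []           = []
climb v (false ∷ bs) = v ∷ climb v bs
climb v (true ∷ bs)  = suc v ∷ climb (suc v) bs

-- Past the end of the word the missing steps are read as flat.
rises : ∀ n → ℕ → List ℕ → Vec Bool n
rises zero    _ _       = []
rises (suc n) _ []      = replicate (suc n) false
rises (suc n) v (x ∷ t) = (v <ᵇ x) ∷ rises n x t

climb-staircase : ∀ {n} v (bs : Vec Bool n) → Staircase v (climb v bs)
climb-staircase v []           = []
climb-staircase v (false ∷ bs) = flat (climb-staircase v bs)
climb-staircase v (true ∷ bs)  = rise (climb-staircase (suc v) bs)

length-climb : ∀ {n} v (bs : Vec Bool n) → length (climb v bs) ≡ n
length-climb v []           = refl
length-climb v (false ∷ bs) = cong suc (length-climb v bs)
length-climb v (true ∷ bs)  = cong suc (length-climb (suc v) bs)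

rises-climb : ∀ {n} v (bs : Vec Bool n) → rises n v (climb v bs) ≡ bs
rises-climb v []           = refl
rises-climb v (false ∷ bs) rewrite <ᵇ-false (≤-refl {v}) = cong (false ∷_) (rises-climb v bs)
rises-climb v (true ∷ bs)  rewrite <ᵇ-true (n<1+n v)     = cong (true ∷_) (rises-climb (suc v) bs)

climb-rises : ∀ {n v t} → Staircase v t → length t ≡ n → climb v (rises n v t) ≡ t
climb-rises []           refl = refl
climb-rises {v = v} (flat s) refl rewrite <ᵇ-false (≤-refl {v}) = cong (v ∷_) (climb-rises s refl)
climb-rises {v = v} (rise s) refl rewrite <ᵇ-true (n<1+n v)     = cong (suc v ∷_) (climb-rises s refl)

A-010-021↔Vec-Bool : ∀ n → A-010-021 (suc n) ↔ Vec Bool n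
A-010-021↔Vec-Bool n = mk↔ₛ′ steps word steps∘word word∘steps
  where
  open Decidable⇒UIP _≟ᵇ_ using (≡-irrelevant)
  steps : A-010-021 (suc n) → Vec Bool n
  steps ([]    , ())
  steps (x ∷ t , _) = rises n x t
  word : Vec Bool n → A-010-021 (suc n)
  word bs = 0 ∷ climb 0 bs , to T-≡ (staircase⇒inA (climb-staircase 0 bs) (length-climb 0 bs))
  steps∘word : ∀ bs → steps (word bs) ≡ bs
  steps∘word = rises-climb 0
  word∘steps : ∀ w → word (steps w) ≡ w
  word∘steps ([]    , ())
  word∘steps (x ∷ t , h) with inA⇒staircase x t (from T-≡ h)
  ... | refl , len , s = Σ-≡,≡→≡ (cong (0 ∷_) (climb-rises s len) , ≡-irrelevant _ _)

Vec-Bool↔Fin : ∀ n → Vec Bool n ↔ Fin (2 ^ n)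
Vec-Bool↔Fin zero    = mk↔ₛ′ (λ _ → zero) (λ _ → []) (λ { zero → refl }) (λ { [] → refl })
Vec-Bool↔Fin (suc n) = ↔-trans ∷↔× (↔-trans (↔-sym 2↔Bool ×-↔ Vec-Bool↔Fin n) (↔-sym *↔×))
  where
  ∷↔× : Vec Bool (suc n) ↔ (Bool × Vec Bool n)
  ∷↔× = mk↔ₛ′ uncons (uncurry _∷_) (λ _ → refl) (λ { (_ ∷ _) → refl })

proposition2p1 : (n : ℕ) → A-010-021 (suc n) ↔ Fin (2 ^ n)
proposition2p1 n = ↔-trans (A-010-021↔Vec-Bool n) (Vec-Bool↔Fin n)
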